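{- Let $n\ge 1$ and $\mathbf{x}\in\{0,1\}^n$. Let $\omega=\omega(\mathbf{x}')$ be the Hamming weight of the derivative sequence $\mathbf{x}'$, let $m$ be the number of 1-runs in $\mathbf{x}'$, and let $m_1$ be the number of 1-runs of length $1$ in $\mathbf{x}'$. Then (a) $|\Phi_1(\mathbf{x})| = 1+\omega = r(\mathbf{x})$; (b) $|\Phi_2(\mathbf{x})| = 1+m+\binom{\omega}{2}$; (c) $|\Phi_3(\mathbf{x})| = 1+m_1+m(\omega-3)+\binom{\omega}{3}-\binom{\omega}{2}+2\omega$.
   Context: Let $\Sigma=\{0,1\}$. For $\mathbf{x}=(x_1,\dots,x_n)\in\Sigma^n$, its derivative sequence is $\mathbf{x}'=(x'_2,\dots,x'_n)$ with $x'_j=x_{j-1}\oplus x_j$ (addition mod 2). A run of a binary sequence is a maximal substring of consecutive identical symbols; a 1-run is a run of 1s; $r(\mathbf{x})$ is the number of runs of $\mathbf{x}$. A grain pattern is a subset $E\subseteq\{2,\dots,n\}$ containing no two consecutive integers; $\mathcal{E}_{n,t}$ is the set of grain patterns with $|E|\le t$. For a grain pattern $E$, $\phi_E:\Sigma^n\to\Sigma^n$ maps $\mathbf{x}$ to $\mathbf{y}$ with $y_j=x_{j-1}$ if $j\in E$ and $y_j=x_j$ otherwise. $\Phi_t(\mathbf{x})=\{\phi_E(\mathbf{x}):E\in\mathcal{E}_{n,t}\}$. Binomial coefficients $\binom{a}{b}$ are $0$ when $a<b$ (in particular when $a<0$). -}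

module Defs where

open import Data.Bool using (Bool; true; false; _∧_; _xor_; if_then_else_)
open import Data.Bool.Properties using () renaming (_≟_ to _≟B_)
open import Data.Nat using (ℕ; zero; suc; _+_; _≤_)
open import Data.Product using (Σ; _×_; _,_; ∃)
open import Data.Unit using (⊤)
open import Data.List using (List; []; _∷_; length)
open import Data.Vec using (Vec; []; _∷_; toList)
open import Data.List.Relation.Unary.Unique.Propositional using (Unique)
open import Data.List.Membership.Propositional using (_∈_)
open import Function.Bundles using (_⇔_)
open import Relation.Binary.PropositionalEquality using (_≡_)
open import Relation.Nullary using (does)

-- Binary sequences x ∈ Σ^n are Vec Bool n (false = 0, true = 1);
-- vector index i (Fin n) corresponds to paper position i+1.

derivL : List Bool → List Bool
derivL [] = []
derivL (a ∷ []) = []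
derivL (a ∷ b ∷ xs) = (a xor b) ∷ derivL (b ∷ xs)

deriv : ∀ {n} → Vec Bool n → List Bool
deriv x = derivL (toList x)

consRun : Bool → List (Bool × ℕ) → List (Bool × ℕ)
consRun a [] = (a , 1) ∷ []
consRun a ((b , k) ∷ rs) =
  if does (a ≟B b) then (b , suc k) ∷ rs else (a , 1) ∷ (b , k) ∷ rs

runsOf : List Bool → List (Bool × ℕ)
runsOf [] = []
runsOf (a ∷ xs) = consRun a (runsOf xs)

r : ∀ {n} → Vec Bool n → ℕ
r x = length (runsOf (toList x))

countOneRuns : List (Bool × ℕ) → ℕ
countOneRuns [] = 0
countOneRuns ((true , _) ∷ rs) = suc (countOneRuns rs)
countOneRuns ((false , _) ∷ rs) = countOneRuns rs

countOneRuns1 : List (Bool × ℕ) → ℕ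
countOneRuns1 [] = 0
countOneRuns1 ((true , 1) ∷ rs) = suc (countOneRuns1 rs)
countOneRuns1 ((_ , _) ∷ rs) = countOneRuns1 rs

oneRuns : List Bool → ℕ
oneRuns s = countOneRuns (runsOf s)

oneRunsLen1 : List Bool → ℕ
oneRunsLen1 s = countOneRuns1 (runsOf s)

weight : List Bool → ℕ
weight [] = 0
weight (true ∷ xs) = suc (weight xs)
weight (false ∷ xs) = weight xs

-- Grain patterns E ⊆ {2,…,n} are represented by their indicator
-- vector E : Vec Bool n (entry i ↔ position i+1 ∈ E).
NoAdj : ∀ {n} → Vec Bool n → Set
NoAdj [] = ⊤
NoAdj (a ∷ []) = ⊤
NoAdj (a ∷ b ∷ E) = (a ∧ b ≡ false) × NoAdj (b ∷ E)

IsGrain : ∀ {n} → Vec Bool n → Set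
IsGrain [] = ⊤
IsGrain (e ∷ E) = (e ≡ false) × NoAdj (e ∷ E)

card : ∀ {n} → Vec Bool n → ℕ
card E = weight (toList E)

-- φ_E(x): y_j = x_{j-1} if j ∈ E, else x_j.
-- phiAux p E x : p is the symbol preceding the current block of x.
phiAux : ∀ {n} → Bool → Vec Bool n → Vec Bool n → Vec Bool n
phiAux p [] [] = []
phiAux p (e ∷ E) (a ∷ x) = (if e then p else a) ∷ phiAux a E x

-- At position 1 the grain-pattern condition forces e = false, so the
-- dummy predecessor `false` is never used for grain patterns.
φ : ∀ {n} → Vec Bool n → Vec Bool n → Vec Bool n
φ E x = phiAux false E x

InΦ : ∀ {n} → ℕ → Vec Bool n → Vec Bool n → Set
InΦ t x y = ∃ λ E → IsGrain E × card E ≤ t × φ E x ≡ y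

HasSize : ∀ {n} → (Vec Bool n → Set) → ℕ → Set
HasSize {n} P k =
  Σ (List (Vec Bool n)) λ L → Unique L × (∀ y → (y ∈ L) ⇔ P y) × length L ≡ k

ω : ∀ {n} → Vec Bool n → ℕ
ω x = weight (deriv x)

mRuns : ∀ {n} → Vec Bool n → ℕ
mRuns x = oneRuns (deriv x)

m₁Runs : ∀ {n} → Vec Bool n → ℕ
m₁Runs x = oneRunsLen1 (deriv x)

-- A grain at position j changes x only if x_{j-1} ≠ x_j, i.e. if x'_j = 1, so every
-- element of Φ_t(x) is φ_E(x) for a grain pattern E contained in the support of x';
-- and distinct such patterns give distinct images, since at the first position where
-- they differ one copies x_{j-1} and the other keeps x_j ≠ x_{j-1}.  Hence |Φ_t(x)| is
-- the number of sets of at most t pairwise non-adjacent positions of ones of x'.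
-- Counting them position by position along x' gives 1 + ω for t = 1 (this also equals
-- the number of runs of x), and recurrences for t = 2, 3 that the closed forms in ω, m
-- and m₁ satisfy as well.
module Submission where

open import Defs
open import Data.Bool using (Bool; true; false; _∧_; _xor_; not; if_then_else_)
open import Data.Bool.Properties using (not-¬; if-float)
open import Data.Nat using (ℕ; zero; suc; _≤_; _+_; z≤n; s≤s)
open import Data.Nat.Properties using (m≤n⇒m≤1+n; +-identityʳ; +-comm)
open import Data.Nat.Combinatorics using (_C_; nC1≡n; nCk+nC[k+1]≡[n+1]C[k+1])
open import Data.Integer using (ℤ; +_; _-_; _*_) renaming (_+_ to _+ℤ_)
open import Data.Product using (Σ; _×_; _,_; ∃; ∃₂)
open import Data.Sum using (inj₁; inj₂)
open import Data.Unit using (⊤; tt)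
open import Data.Empty using (⊥)
open import Data.List using (List; []; _∷_; length; map; _++_)
open import Data.List.Properties using (length-map; length-++)
open import Data.Vec using (Vec; []; _∷_; toList; head)
open import Data.Vec.Properties using (∷-injectiveʳ)
open import Data.List.Relation.Unary.Unique.Propositional using (Unique)
open import Data.List.Relation.Unary.Unique.Propositional.Properties using (map⁺; ++⁺)
open import Data.List.Relation.Unary.Any using (here)
import Data.List.Relation.Unary.All as All
import Data.List.Relation.Unary.AllPairs as AllPairs
open import Data.List.Membership.Propositional using (_∈_)
open import Data.List.Membership.Propositional.Properties
  using (∈-map⁺; ∈-map⁻; ∈-++⁺ˡ; ∈-++⁺ʳ; ∈-++⁻)
open import Function.Bundles using (_⇔_; mk⇔)
open import Function.Properties.Equivalence using () renaming (trans to ⇔-trans)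
open import Relation.Binary.PropositionalEquality
  using (_≡_; refl; sym; trans; cong; cong₂; subst; module ≡-Reasoning)
import Data.Nat.Tactic.RingSolver as ℕ-Solver
import Data.Integer.Tactic.RingSolver as ℤ-Solver

open ≡-Reasoning

Sparse : ∀ {n} → Bool → Vec Bool n → Set
Sparse free [] = ⊤
Sparse free (e ∷ E) = (e ∧ not free ≡ false) × Sparse (not e) E

Sparse-weaken : ∀ {n} (E : Vec Bool n) → Sparse false E → Sparse true E
Sparse-weaken [] _ = tt
Sparse-weaken (false ∷ E) (_ , s) = refl , s
Sparse-weaken (true ∷ E) (_ , s) = refl , s

NoAdj⇒Sparse : ∀ {n} e (E : Vec Bool n) → NoAdj (e ∷ E) → Sparse (not e) E
NoAdj⇒Sparse e [] _ = tt
NoAdj⇒Sparse false (false ∷ E) (_ , na) = refl , NoAdj⇒Sparse false E na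
NoAdj⇒Sparse false (true ∷ E) (_ , na) = refl , NoAdj⇒Sparse true E na
NoAdj⇒Sparse true (false ∷ E) (_ , na) = refl , NoAdj⇒Sparse false E na
NoAdj⇒Sparse true (true ∷ E) (() , _)

Sparse⇒NoAdj : ∀ {n} e (E : Vec Bool n) → Sparse (not e) E → NoAdj (e ∷ E)
Sparse⇒NoAdj e [] _ = tt
Sparse⇒NoAdj false (f ∷ E) (_ , s) = refl , Sparse⇒NoAdj f E s
Sparse⇒NoAdj true (false ∷ E) (_ , s) = refl , Sparse⇒NoAdj false E s
Sparse⇒NoAdj true (true ∷ E) (() , _)

IsGrain⇒Sparse : ∀ {n} (E : Vec Bool n) → IsGrain E → Sparse false E
IsGrain⇒Sparse [] _ = tt
IsGrain⇒Sparse (.false ∷ E) (refl , na) = refl , NoAdj⇒Sparse false E na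

Sparse⇒IsGrain : ∀ {n} (E : Vec Bool n) → Sparse false E → IsGrain E
Sparse⇒IsGrain [] _ = tt
Sparse⇒IsGrain (false ∷ E) (_ , s) = refl , Sparse⇒NoAdj false E s
Sparse⇒IsGrain (true ∷ E) (() , _)

-- Images of a suffix of x, given the preceding symbol p and whether its first position
-- may carry a grain.
Image : ∀ {n} → ℕ → Bool → Bool → Vec Bool n → Vec Bool n → Set
Image t p free x y = ∃ λ E → Sparse free E × card E ≤ t × phiAux p E x ≡ y

Image⇔InΦ : ∀ {n} t (x y : Vec Bool n) → Image t false false x y ⇔ InΦ t x y
Image⇔InΦ t x y =
  mk⇔ (λ { (E , s , c , eq) → E , Sparse⇒IsGrain E s , c , eq })
      (λ { (E , g , c , eq) → E , IsGrain⇒Sparse E g , c , eq })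

-- A grain is placed only where it changes the symbol (p xor a).
images : ∀ {n} → ℕ → Bool → Bool → Vec Bool n → List (Vec Bool n)
images t p free [] = [] ∷ []
images t p false (a ∷ x) = map (a ∷_) (images t a true x)
images zero p true (a ∷ x) = map (a ∷_) (images zero a true x)
images (suc t) p true (a ∷ x) =
  map (a ∷_) (images (suc t) a true x)
    ++ (if p xor a then map (p ∷_) (images t a false x) else [])

Image-keep : ∀ {n} t p free a {x y : Vec Bool n} →
             Image t a true x y → Image t p free (a ∷ x) (a ∷ y)
Image-keep t p free a (E , s , c , refl) = false ∷ E , (refl , s) , c , refl

Image-shift : ∀ {n} t p a {x y : Vec Bool n} →
              Image t a false x y → Image (suc t) p true (a ∷ x) (p ∷ y)
Image-shift t p a (E , s , c , refl) = true ∷ E , (refl , s) , s≤s c , refl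

images-sound : ∀ {n} t p free (x y : Vec Bool n) → y ∈ images t p free x → Image t p free x y
images-sound t p free [] [] (here refl) = [] , tt , z≤n , refl
images-sound t p false (a ∷ x) y y∈ with ∈-map⁻ (a ∷_) y∈
... | y′ , y′∈ , refl = Image-keep t p false a (images-sound t a true x y′ y′∈)
images-sound zero p true (a ∷ x) y y∈ with ∈-map⁻ (a ∷_) y∈
... | y′ , y′∈ , refl = Image-keep zero p true a (images-sound zero a true x y′ y′∈)
images-sound (suc t) p true (a ∷ x) y y∈ with ∈-++⁻ (map (a ∷_) (images (suc t) a true x)) y∈
... | inj₁ y∈kept with ∈-map⁻ (a ∷_) y∈kept
...   | y′ , y′∈ , refl = Image-keep (suc t) p true a (images-sound (suc t) a true x y′ y′∈)
images-sound (suc t) true true (false ∷ x) y y∈ | inj₂ y∈shifted with ∈-map⁻ (true ∷_) y∈shifted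
...   | y′ , y′∈ , refl = Image-shift t true false (images-sound t false false x y′ y′∈)
images-sound (suc t) false true (true ∷ x) y y∈ | inj₂ y∈shifted with ∈-map⁻ (false ∷_) y∈shifted
...   | y′ , y′∈ , refl = Image-shift t false true (images-sound t true false x y′ y′∈)
images-sound (suc t) true true (true ∷ x) y y∈ | inj₂ ()
images-sound (suc t) false true (false ∷ x) y y∈ | inj₂ ()

∈-images-keep : ∀ {n} t p free a (x y : Vec Bool n) →
                y ∈ images t a true x → (a ∷ y) ∈ images t p free (a ∷ x)
∈-images-keep t p false a x y y∈ = ∈-map⁺ (a ∷_) y∈
∈-images-keep zero p true a x y y∈ = ∈-map⁺ (a ∷_) y∈
∈-images-keep (suc t) p true a x y y∈ = ∈-++⁺ˡ (∈-map⁺ (a ∷_) y∈)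

∈-images-shift : ∀ {n} t a (x y : Vec Bool n) →
                 y ∈ images t a false x → (not a ∷ y) ∈ images (suc t) (not a) true (a ∷ x)
∈-images-shift t true x y y∈ =
  ∈-++⁺ʳ (map (true ∷_) (images (suc t) true true x)) (∈-map⁺ (false ∷_) y∈)
∈-images-shift t false x y y∈ =
  ∈-++⁺ʳ (map (false ∷_) (images (suc t) false true x)) (∈-map⁺ (true ∷_) y∈)

-- A grain between two equal symbols can be dropped without changing the image.
images-complete : ∀ {n} t p free (x y : Vec Bool n) → Image t p free x y → y ∈ images t p free x
images-complete t p free [] [] ([] , _) = here refl
images-complete t p free (a ∷ x) _ (false ∷ E , (_ , s) , c , refl) =
  ∈-images-keep t p free a x _ (images-complete t a true x _ (E , s , c , refl))
images-complete t p false (a ∷ x) _ (true ∷ E , (() , _) , _)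
images-complete (suc t) true true (false ∷ x) _ (true ∷ E , (_ , s) , s≤s c , refl) =
  ∈-images-shift t false x _ (images-complete t false false x _ (E , s , c , refl))
images-complete (suc t) false true (true ∷ x) _ (true ∷ E , (_ , s) , s≤s c , refl) =
  ∈-images-shift t true x _ (images-complete t true false x _ (E , s , c , refl))
images-complete (suc t) true true (true ∷ x) _ (true ∷ E , (_ , s) , s≤s c , refl) =
  ∈-images-keep (suc t) true true true x _
    (images-complete (suc t) true true x _ (E , Sparse-weaken E s , m≤n⇒m≤1+n c , refl))
images-complete (suc t) false true (false ∷ x) _ (true ∷ E , (_ , s) , s≤s c , refl) =
  ∈-images-keep (suc t) false true false x _
    (images-complete (suc t) false true x _ (E , Sparse-weaken E s , m≤n⇒m≤1+n c , refl))

∈-map-∷⇒head : ∀ {n} a {v : Vec Bool (suc n)} {L : List (Vec Bool n)} → v ∈ map (a ∷_) L → head v ≡ a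
∈-map-∷⇒head a v∈ with ∈-map⁻ (a ∷_) v∈
... | _ , _ , refl = refl

map-∷-disjoint : ∀ {n} a {L L′ : List (Vec Bool n)} {v} →
                 v ∈ map (a ∷_) L × v ∈ map (not a ∷_) L′ → ⊥
map-∷-disjoint a (v∈ , v∈′) = not-¬ (∈-map-∷⇒head a v∈) (∈-map-∷⇒head (not a) v∈′)

images-unique : ∀ {n} t p free (x : Vec Bool n) → Unique (images t p free x)
images-unique t p free [] = All.[] AllPairs.∷ AllPairs.[]
images-unique t p false (a ∷ x) = map⁺ ∷-injectiveʳ (images-unique t a true x)
images-unique zero p true (a ∷ x) = map⁺ ∷-injectiveʳ (images-unique zero a true x)
images-unique (suc t) true true (false ∷ x) =
  ++⁺ (map⁺ ∷-injectiveʳ (images-unique (suc t) false true x))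
      (map⁺ ∷-injectiveʳ (images-unique t false false x)) (map-∷-disjoint false)
images-unique (suc t) false true (true ∷ x) =
  ++⁺ (map⁺ ∷-injectiveʳ (images-unique (suc t) true true x))
      (map⁺ ∷-injectiveʳ (images-unique t true false x)) (map-∷-disjoint true)
images-unique (suc t) true true (true ∷ x) =
  ++⁺ (map⁺ ∷-injectiveʳ (images-unique (suc t) true true x)) AllPairs.[] (λ { (_ , ()) })
images-unique (suc t) false true (false ∷ x) =
  ++⁺ (map⁺ ∷-injectiveʳ (images-unique (suc t) false true x)) AllPairs.[] (λ { (_ , ()) })

-- The number of sets of at most t pairwise non-adjacent positions of ones of a list,
-- whose first position may be used only if `free`.
countSparse : ℕ → Bool → List Bool → ℕ
countSparse t free [] = 1
countSparse t false (d ∷ ds) = countSparse t true ds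
countSparse zero true (d ∷ ds) = countSparse zero true ds
countSparse (suc t) true (d ∷ ds) =
  countSparse (suc t) true ds + (if d then countSparse t false ds else 0)

length-images : ∀ {n} t p free (x : Vec Bool n) →
                length (images t p free x) ≡ countSparse t free (derivL (p ∷ toList x))

length-map-∷-images : ∀ {n} t p free b (x : Vec Bool n) →
  length (map (b ∷_) (images t p free x)) ≡ countSparse t free (derivL (p ∷ toList x))
length-map-∷-images t p free b x =
  trans (length-map (b ∷_) (images t p free x)) (length-images t p free x)

length-images t p free [] = refl
length-images t p false (a ∷ x) = length-map-∷-images t a true a x
length-images zero p true (a ∷ x) = length-map-∷-images zero a true a x
length-images (suc t) p true (a ∷ x) = begin
  length (kept ++ shifted)
    ≡⟨ length-++ kept ⟩
  length kept + length shifted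
    ≡⟨ cong (λ l → length kept + l) (if-float length (p xor a)) ⟩
  length kept + (if p xor a then length (map (p ∷_) (images t a false x)) else 0)
    ≡⟨ cong₂ (λ k l → k + (if p xor a then l else 0))
             (length-map-∷-images (suc t) a true a x) (length-map-∷-images t a false p x) ⟩
  countSparse (suc t) true (derivL (a ∷ toList x))
    + (if p xor a then countSparse t false (derivL (a ∷ toList x)) else 0) ∎
  where
  kept shifted : List (Vec Bool (suc _))
  kept = map (a ∷_) (images (suc t) a true x)
  shifted = if p xor a then map (p ∷_) (images t a false x) else []

Φ-size : ∀ {n} t (x : Vec Bool n) → HasSize (InΦ t x) (countSparse t true (deriv x))
Φ-size t x =
  images t false false x ,
  images-unique t false false x ,
  (λ y → ⇔-trans (mk⇔ (images-sound t false false x y) (images-complete t false false x y))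
                 (Image⇔InΦ t x y)) ,
  length-images-top x
  where
  length-images-top : ∀ {n} (x : Vec Bool n) →
                      length (images t false false x) ≡ countSparse t true (deriv x)
  length-images-top [] = refl
  length-images-top (a ∷ x) = length-images t false false (a ∷ x)

consRun-head : ∀ a rs → ∃₂ λ k rs′ → consRun a rs ≡ (a , suc k) ∷ rs′
consRun-head a [] = 0 , [] , refl
consRun-head true ((true , k) ∷ rs) = k , rs , refl
consRun-head true ((false , k) ∷ rs) = 0 , (false , k) ∷ rs , refl
consRun-head false ((true , k) ∷ rs) = 0 , (true , k) ∷ rs , refl
consRun-head false ((false , k) ∷ rs) = k , rs , refl

consRun-true-false : ∀ rs → consRun true (consRun false rs) ≡ (true , 1) ∷ consRun false rs
consRun-true-false [] = refl
consRun-true-false ((true , k) ∷ rs) = refl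
consRun-true-false ((false , k) ∷ rs) = refl

countOneRuns-consRun-false : ∀ rs → countOneRuns (consRun false rs) ≡ countOneRuns rs
countOneRuns-consRun-false [] = refl
countOneRuns-consRun-false ((true , k) ∷ rs) = refl
countOneRuns-consRun-false ((false , k) ∷ rs) = refl

countOneRuns1-consRun-false : ∀ rs → countOneRuns1 (consRun false rs) ≡ countOneRuns1 rs
countOneRuns1-consRun-false [] = refl
countOneRuns1-consRun-false ((true , k) ∷ rs) = refl
countOneRuns1-consRun-false ((false , k) ∷ rs) = refl

length-runsOf : ∀ a l → length (runsOf (a ∷ l)) ≡ 1 + weight (derivL (a ∷ l))
length-runsOf a [] = refl
length-runsOf true (true ∷ l)
  with runsOf (true ∷ l) | consRun-head true (runsOf l) | length-runsOf true l
... | _ | _ , _ , refl | ih = ih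
length-runsOf false (false ∷ l)
  with runsOf (false ∷ l) | consRun-head false (runsOf l) | length-runsOf false l
... | _ | _ , _ , refl | ih = ih
length-runsOf true (false ∷ l)
  with runsOf (false ∷ l) | consRun-head false (runsOf l) | length-runsOf false l
... | _ | _ , _ , refl | ih = cong suc ih
length-runsOf false (true ∷ l)
  with runsOf (true ∷ l) | consRun-head true (runsOf l) | length-runsOf true l
... | _ | _ , _ , refl | ih = cong suc ih

oneRuns-false∷ : ∀ l → oneRuns (false ∷ l) ≡ oneRuns l
oneRuns-false∷ l = countOneRuns-consRun-false (runsOf l)

oneRuns-true∷false∷ : ∀ l → oneRuns (true ∷ false ∷ l) ≡ suc (oneRuns l)
oneRuns-true∷false∷ l =
  trans (cong countOneRuns (consRun-true-false (runsOf l))) (cong suc (oneRuns-false∷ l))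

oneRuns-true∷true∷ : ∀ l → oneRuns (true ∷ true ∷ l) ≡ oneRuns (true ∷ l)
oneRuns-true∷true∷ l with runsOf (true ∷ l) | consRun-head true (runsOf l)
... | _ | _ , _ , refl = refl

oneRunsLen1-false∷ : ∀ l → oneRunsLen1 (false ∷ l) ≡ oneRunsLen1 l
oneRunsLen1-false∷ l = countOneRuns1-consRun-false (runsOf l)

oneRunsLen1-true∷false∷ : ∀ l → oneRunsLen1 (true ∷ false ∷ l) ≡ suc (oneRunsLen1 l)
oneRunsLen1-true∷false∷ l =
  trans (cong countOneRuns1 (consRun-true-false (runsOf l))) (cong suc (oneRunsLen1-false∷ l))

oneRunsLen1-true∷true∷false∷ : ∀ l → oneRunsLen1 (true ∷ true ∷ false ∷ l) ≡ oneRunsLen1 l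
oneRunsLen1-true∷true∷false∷ l =
  trans (cong (λ rs → countOneRuns1 (consRun true rs)) (consRun-true-false (runsOf l)))
        (oneRunsLen1-false∷ l)

oneRunsLen1-true∷true∷true∷ : ∀ l →
  oneRunsLen1 (true ∷ true ∷ true ∷ l) ≡ oneRunsLen1 (true ∷ true ∷ l)
oneRunsLen1-true∷true∷true∷ l with runsOf (true ∷ l) | consRun-head true (runsOf l)
... | _ | _ , _ , refl = refl

suc-C2 : ∀ w → suc w C 2 ≡ w + w C 2
suc-C2 w = trans (sym (nCk+nC[k+1]≡[n+1]C[k+1] w 1)) (cong (_+ w C 2) (nC1≡n w))

suc-C3 : ∀ w → suc w C 3 ≡ w C 2 + w C 3
suc-C3 w = sym (nCk+nC[k+1]≡[n+1]C[k+1] w 2)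

countSparse-zero : ∀ free ds → countSparse 0 free ds ≡ 1
countSparse-zero free [] = refl
countSparse-zero false (d ∷ ds) = countSparse-zero true ds
countSparse-zero true (d ∷ ds) = countSparse-zero true ds

countSparse-one : ∀ ds → countSparse 1 true ds ≡ 1 + weight ds
countSparse-one [] = refl
countSparse-one (false ∷ ds) = trans (+-identityʳ _) (countSparse-one ds)
countSparse-one (true ∷ ds) = begin
  countSparse 1 true ds + countSparse 0 false ds
    ≡⟨ cong₂ _+_ (countSparse-one ds) (countSparse-zero false ds) ⟩
  1 + weight ds + 1
    ≡⟨ +-comm (1 + weight ds) 1 ⟩
  1 + weight (true ∷ ds) ∎

countSparse-two : ∀ ds → countSparse 2 true ds ≡ 1 + oneRuns ds + weight ds C 2
countSparse-two [] = refl
countSparse-two (false ∷ ds) = begin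
  countSparse 2 true ds + 0
    ≡⟨ trans (+-identityʳ _) (countSparse-two ds) ⟩
  1 + oneRuns ds + weight ds C 2
    ≡⟨ cong (λ m → 1 + m + weight ds C 2) (sym (oneRuns-false∷ ds)) ⟩
  1 + oneRuns (false ∷ ds) + weight ds C 2 ∎
countSparse-two (true ∷ []) = refl
countSparse-two (true ∷ false ∷ ds) = begin
  countSparse 2 true ds + 0 + countSparse 1 true ds
    ≡⟨ cong₂ _+_ (trans (+-identityʳ _) (countSparse-two ds)) (countSparse-one ds) ⟩
  1 + m + w C 2 + (1 + w)
    ≡⟨ rearrange m w (w C 2) ⟩
  1 + suc m + (w + w C 2)
    ≡⟨ cong₂ (λ m c → 1 + m + c) (sym (oneRuns-true∷false∷ ds)) (sym (suc-C2 w)) ⟩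
  1 + oneRuns (true ∷ false ∷ ds) + suc w C 2 ∎
  where
  m = oneRuns ds
  w = weight ds
  rearrange : ∀ m w c → 1 + m + c + (1 + w) ≡ 1 + suc m + (w + c)
  rearrange = ℕ-Solver.solve-∀
countSparse-two (true ∷ true ∷ ds) = begin
  countSparse 2 true (true ∷ ds) + countSparse 1 true ds
    ≡⟨ cong₂ _+_ (countSparse-two (true ∷ ds)) (countSparse-one ds) ⟩
  1 + m + suc w C 2 + (1 + w)
    ≡⟨ rearrange m w (suc w C 2) ⟩
  1 + m + (suc w + suc w C 2)
    ≡⟨ cong₂ (λ m c → 1 + m + c) (sym (oneRuns-true∷true∷ ds)) (sym (suc-C2 (suc w))) ⟩
  1 + oneRuns (true ∷ true ∷ ds) + suc (suc w) C 2 ∎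
  where
  m = oneRuns (true ∷ ds)
  w = weight ds
  rearrange : ∀ m w c → 1 + m + c + (1 + w) ≡ 1 + m + (suc w + c)
  rearrange = ℕ-Solver.solve-∀

size₃ : ℕ → ℕ → ℕ → ℤ
size₃ w m m₁ = + 1 +ℤ + m₁ +ℤ + m * (+ w - + 3) +ℤ + (w C 3) - + (w C 2) +ℤ + 2 * + w

-- size₃ with its binomial coefficients replaced by variables, so that the ring solver
-- can treat them as atoms.
size₃-poly : (w m m₁ c₂ c₃ : ℤ) → ℤ
size₃-poly w m m₁ c₂ c₃ = + 1 +ℤ m₁ +ℤ m * (w - + 3) +ℤ c₃ - c₂ +ℤ + 2 * w

size₃-suc : ∀ w m m₁ →
  size₃ (suc w) m m₁ ≡
    size₃-poly (+ 1 +ℤ + w) (+ m) (+ m₁) (+ w +ℤ + (w C 2)) (+ (w C 2) +ℤ + (w C 3))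
size₃-suc w m m₁ =
  cong₂ (λ c₂ c₃ → size₃-poly (+ suc w) (+ m) (+ m₁) (+ c₂) (+ c₃)) (suc-C2 w) (suc-C3 w)

size₃-suc-suc : ∀ w m m₁ →
  size₃ (suc (suc w)) m m₁ ≡
    size₃-poly (+ 2 +ℤ + w) (+ m) (+ m₁)
               (+ 1 +ℤ + w +ℤ (+ w +ℤ + (w C 2)))
               ((+ w +ℤ + (w C 2)) +ℤ (+ (w C 2) +ℤ + (w C 3)))
size₃-suc-suc w m m₁ =
  cong₂ (λ c₂ c₃ → size₃-poly (+ suc (suc w)) (+ m) (+ m₁) (+ c₂) (+ c₃))
        (trans (suc-C2 (suc w)) (cong (λ c → suc w + c) (suc-C2 w)))
        (trans (suc-C3 (suc w)) (cong₂ _+_ (suc-C2 w) (suc-C3 w)))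

size₃-new-run : ∀ w m m₁ →
  size₃ (suc w) (suc m) (suc m₁) ≡ size₃ w m m₁ +ℤ + (1 + m + w C 2)
size₃-new-run w m m₁ =
  trans (size₃-suc w (suc m) (suc m₁)) (identity (+ w) (+ m) (+ m₁) (+ (w C 2)) (+ (w C 3)))
  where
  identity : ∀ w m m₁ c₂ c₃ →
    + 1 +ℤ (+ 1 +ℤ m₁) +ℤ (+ 1 +ℤ m) * ((+ 1 +ℤ w) - + 3) +ℤ (c₂ +ℤ c₃) - (w +ℤ c₂)
        +ℤ + 2 * (+ 1 +ℤ w)
      ≡ (+ 1 +ℤ m₁ +ℤ m * (w - + 3) +ℤ c₃ - c₂ +ℤ + 2 * w) +ℤ (+ 1 +ℤ m +ℤ c₂)
  identity = ℤ-Solver.solve-∀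

size₃-extend-long-run : ∀ w m m₁ →
  size₃ (suc (suc w)) m m₁ ≡ size₃ (suc w) m m₁ +ℤ + (1 + m + w C 2)
size₃-extend-long-run w m m₁ =
  trans (size₃-suc-suc w m m₁)
        (trans (identity (+ w) (+ m) (+ m₁) (+ (w C 2)) (+ (w C 3)))
               (cong (_+ℤ + (1 + m + w C 2)) (sym (size₃-suc w m m₁))))
  where
  identity : ∀ w m m₁ c₂ c₃ →
    + 1 +ℤ m₁ +ℤ m * ((+ 2 +ℤ w) - + 3) +ℤ ((w +ℤ c₂) +ℤ (c₂ +ℤ c₃)) - (+ 1 +ℤ w +ℤ (w +ℤ c₂))
        +ℤ + 2 * (+ 2 +ℤ w)
      ≡ (+ 1 +ℤ m₁ +ℤ m * ((+ 1 +ℤ w) - + 3) +ℤ (c₂ +ℤ c₃) - (w +ℤ c₂) +ℤ + 2 * (+ 1 +ℤ w))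
          +ℤ (+ 1 +ℤ m +ℤ c₂)
  identity = ℤ-Solver.solve-∀

size₃-extend-short-run : ∀ w m m₁ →
  size₃ (suc (suc w)) (suc m) m₁ ≡ size₃ (suc w) (suc m) (suc m₁) +ℤ + (1 + m + w C 2)
size₃-extend-short-run w m m₁ =
  trans (size₃-suc-suc w (suc m) m₁)
        (trans (identity (+ w) (+ m) (+ m₁) (+ (w C 2)) (+ (w C 3)))
               (cong (_+ℤ + (1 + m + w C 2)) (sym (size₃-suc w (suc m) (suc m₁)))))
  where
  identity : ∀ w m m₁ c₂ c₃ →
    + 1 +ℤ m₁ +ℤ (+ 1 +ℤ m) * ((+ 2 +ℤ w) - + 3) +ℤ ((w +ℤ c₂) +ℤ (c₂ +ℤ c₃))
        - (+ 1 +ℤ w +ℤ (w +ℤ c₂)) +ℤ + 2 * (+ 2 +ℤ w)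
      ≡ (+ 1 +ℤ (+ 1 +ℤ m₁) +ℤ (+ 1 +ℤ m) * ((+ 1 +ℤ w) - + 3) +ℤ (c₂ +ℤ c₃) - (w +ℤ c₂)
            +ℤ + 2 * (+ 1 +ℤ w))
          +ℤ (+ 1 +ℤ m +ℤ c₂)
  identity = ℤ-Solver.solve-∀

countSparse-three : ∀ ds → + countSparse 3 true ds ≡ size₃ (weight ds) (oneRuns ds) (oneRunsLen1 ds)
countSparse-three [] = refl
countSparse-three (false ∷ ds) = begin
  + (countSparse 3 true ds + 0)
    ≡⟨ trans (cong +_ (+-identityʳ _)) (countSparse-three ds) ⟩
  size₃ (weight ds) (oneRuns ds) (oneRunsLen1 ds)
    ≡⟨ cong₂ (size₃ (weight ds)) (sym (oneRuns-false∷ ds)) (sym (oneRunsLen1-false∷ ds)) ⟩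
  size₃ (weight ds) (oneRuns (false ∷ ds)) (oneRunsLen1 (false ∷ ds)) ∎
countSparse-three (true ∷ []) = refl
countSparse-three (true ∷ false ∷ ds) = begin
  + (countSparse 3 true ds + 0) +ℤ + countSparse 2 true ds
    ≡⟨ cong₂ _+ℤ_ (trans (cong +_ (+-identityʳ _)) (countSparse-three ds))
                  (cong +_ (countSparse-two ds)) ⟩
  size₃ w m m₁ +ℤ + (1 + m + w C 2)
    ≡⟨ sym (size₃-new-run w m m₁) ⟩
  size₃ (suc w) (suc m) (suc m₁)
    ≡⟨ cong₂ (size₃ (suc w)) (sym (oneRuns-true∷false∷ ds)) (sym (oneRunsLen1-true∷false∷ ds)) ⟩
  size₃ (suc w) (oneRuns (true ∷ false ∷ ds)) (oneRunsLen1 (true ∷ false ∷ ds)) ∎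
  where
  w = weight ds
  m = oneRuns ds
  m₁ = oneRunsLen1 ds
countSparse-three (true ∷ true ∷ []) = refl
countSparse-three (true ∷ true ∷ true ∷ ds) = begin
  + countSparse 3 true (true ∷ true ∷ ds) +ℤ + countSparse 2 true (true ∷ ds)
    ≡⟨ cong₂ _+ℤ_ (countSparse-three (true ∷ true ∷ ds)) (cong +_ (countSparse-two (true ∷ ds))) ⟩
  size₃ (suc w) m m₁ +ℤ + (1 + oneRuns (true ∷ ds) + w C 2)
    ≡⟨ cong (λ m′ → size₃ (suc w) m m₁ +ℤ + (1 + m′ + w C 2)) (sym (oneRuns-true∷true∷ ds)) ⟩
  size₃ (suc w) m m₁ +ℤ + (1 + m + w C 2)
    ≡⟨ sym (size₃-extend-long-run w m m₁) ⟩
  size₃ (suc (suc w)) m m₁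
    ≡⟨ cong₂ (size₃ (suc (suc w))) (sym (oneRuns-true∷true∷ (true ∷ ds)))
                                  (sym (oneRunsLen1-true∷true∷true∷ ds)) ⟩
  size₃ (suc (suc w)) (oneRuns (true ∷ true ∷ true ∷ ds)) (oneRunsLen1 (true ∷ true ∷ true ∷ ds)) ∎
  where
  w = weight (true ∷ ds)
  m = oneRuns (true ∷ true ∷ ds)
  m₁ = oneRunsLen1 (true ∷ true ∷ ds)
countSparse-three (true ∷ true ∷ false ∷ ds) = begin
  + countSparse 3 true (true ∷ false ∷ ds) +ℤ + countSparse 2 true (false ∷ ds)
    ≡⟨ cong₂ _+ℤ_ (countSparse-three (true ∷ false ∷ ds)) (cong +_ (countSparse-two (false ∷ ds))) ⟩
  size₃ (suc w) (oneRuns (true ∷ false ∷ ds)) (oneRunsLen1 (true ∷ false ∷ ds))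
    +ℤ + (1 + oneRuns (false ∷ ds) + w C 2)
    ≡⟨ cong₂ _+ℤ_ (cong₂ (size₃ (suc w)) (oneRuns-true∷false∷ ds) (oneRunsLen1-true∷false∷ ds))
                  (cong (λ m′ → + (1 + m′ + w C 2)) (oneRuns-false∷ ds)) ⟩
  size₃ (suc w) (suc m) (suc m₁) +ℤ + (1 + m + w C 2)
    ≡⟨ sym (size₃-extend-short-run w m m₁) ⟩
  size₃ (suc (suc w)) (suc m) m₁
    ≡⟨ cong₂ (size₃ (suc (suc w)))
             (sym (trans (oneRuns-true∷true∷ (false ∷ ds)) (oneRuns-true∷false∷ ds)))
             (sym (oneRunsLen1-true∷true∷false∷ ds)) ⟩
  size₃ (suc (suc w)) (oneRuns (true ∷ true ∷ false ∷ ds)) (oneRunsLen1 (true ∷ true ∷ false ∷ ds)) ∎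
  where
  w = weight ds
  m = oneRuns ds
  m₁ = oneRunsLen1 ds

proposition2p1 : (n : ℕ) → 1 ≤ n → (x : Vec Bool n) →
    (HasSize (InΦ 1 x) (1 + ω x) × 1 + ω x ≡ r x)
    × HasSize (InΦ 2 x) (1 + mRuns x + ω x C 2)
    × (Σ ℕ λ k → HasSize (InΦ 3 x) k ×
        + k ≡ + 1 +ℤ + m₁Runs x +ℤ + mRuns x * (+ ω x - + 3) +ℤ + (ω x C 3) - + (ω x C 2) +ℤ + 2 * + ω x)
proposition2p1 (suc n) _ x@(a ∷ x′) =
  ( subst (HasSize (InΦ 1 x)) (countSparse-one (deriv x)) (Φ-size 1 x)
  , sym (length-runsOf a (toList x′))) ,
  subst (HasSize (InΦ 2 x)) (countSparse-two (deriv x)) (Φ-size 2 x) ,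
  (countSparse 3 true (deriv x) , Φ-size 3 x , countSparse-three (deriv x))
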